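{- Let $G$ be an instance of \textsc{Stable Matching} and let $M_1,\dots,M_k$ be pairwise edge-disjoint stable matchings of $G$. For each man $m$, the women $p_{M_1}(m),\dots,p_{M_k}(m)$ are pairwise distinct; sort them according to $m$'s preference list (most preferred first). For $i\in\{1,\dots,k\}$ let $M_i'=\{(m,w): m\in\mathcal{M},\ w \text{ is the } i\text{ -th woman in this sorted set for } m\}$. Then each $M_i'$ is a stable matching of $G$, $M_i'\cap M_j'=\varnothing$ for $i\neq j$, and $M_1',\dots,M_k'$ form a chain of $k$ pairwise edge-disjoint stable matchings under the dominance relation.
   Context: An instance of \textsc{Stable Matching}: a complete bipartite graph $G$ with sides $\mathcal{M}$ (men) and $\mathcal{W}$ (women), $|\mathcal{M}|=|\mathcal{W}|=n$, where each person has a strictly ordered preference list of all persons of the other side (earlier = more preferred). For a perfect matching $M$, $p_M(x)$ is the partner of $x$. A pair $(m,w)$ blocks $M$ if $w$ prefers $m$ to $p_M(w)$ and $m$ prefers $w$ to $p_M(m)$; $M$ is stable if no pair blocks it. Dominance: a stable matching $M$ dominates a stable matching $M'$ (written $M\prec M'$) if every man gets a strictly more preferred partner in $M$ than in $M'$. A chain is a set of stable matchings totally ordered by $\prec$. -}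

module Defs where

open import Data.Nat using (ℕ; _<_; _<?_)
open import Data.Nat.Properties using ()
open import Data.Fin using (Fin; toℕ)
open import Data.Fin.Properties using (any?)
open import Data.List using (List; length; filter; allFin)
open import Data.Product using (Σ; ∃; _×_; _,_)
open import Data.Sum using (_⊎_)
open import Relation.Nullary using (¬_; yes; no)
open import Relation.Binary.PropositionalEquality using (_≡_; _≢_)
open import Function.Definitions using (Injective)

Man Woman : ℕ → Set
Man n = Fin n
Woman n = Fin n

-- An instance of Stable Matching: each person's strictly ordered preference
-- list over the other side, encoded as the position function
-- (rank x y = position of y in x's list; 0 = most preferred), which is
-- injective (hence a bijection Fin n → Fin n, i.e. a complete strict list).
record Instance (n : ℕ) : Set where
  field
    rankM    : Man n → Woman n → Fin n
    rankM-inj : ∀ m → Injective _≡_ _≡_ (rankM m)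
    rankW    : Woman n → Man n → Fin n
    rankW-inj : ∀ w → Injective _≡_ _≡_ (rankW w)

module _ {n : ℕ} (G : Instance n) where
  open Instance G

  PrefersM : Man n → Woman n → Woman n → Set
  PrefersM m w w' = toℕ (rankM m w) < toℕ (rankM m w')

  PrefersW : Woman n → Man n → Man n → Set
  PrefersW w m m' = toℕ (rankW w m) < toℕ (rankW w m')

-- A matching is given by the partner function of the men, μ m = p_M(m);
-- the edge set is {(m, μ m)}. It is perfect iff μ is injective (bijective).
Matching : ℕ → Set
Matching n = Man n → Woman n

IsPerfect : ∀ {n} → Matching n → Set
IsPerfect μ = Injective _≡_ _≡_ μ

module _ {n : ℕ} (G : Instance n) where

  Blocks : Matching n → Man n → Woman n → Set
  Blocks μ m w =
    (∃ λ m' → μ m' ≡ w × PrefersW G w m m') × PrefersM G m w (μ m)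

  Stable : Matching n → Set
  Stable μ = IsPerfect μ × (∀ m w → ¬ Blocks μ m w)

  Dominates : Matching n → Matching n → Set
  Dominates μ ν = ∀ m → PrefersM G m (μ m) (ν m)

  IsChain : ∀ {k} → (Fin k → Matching n) → Set
  IsChain {k} M = ∀ i j → i ≢ j → Dominates (M i) (M j) ⊎ Dominates (M j) (M i)

EdgeDisjoint : ∀ {n} → Matching n → Matching n → Set
EdgeDisjoint μ ν = ∀ m → μ m ≢ ν m

module _ {n : ℕ} (G : Instance n) where
  open Instance G

  -- For a man m and index j, pos M m j is the number
  -- of j' with M j' m strictly preferred by m to M j m, i.e. (0-based) the
  -- position of M j m in the list p_{M_1}(m),…,p_{M_k}(m) sorted by m's
  -- preferences.
  pos : ∀ {k} → (Fin k → Matching n) → Man n → Fin k → ℕ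
  pos {k} M m j =
    length (filter (λ j' → toℕ (rankM m (M j' m)) <? toℕ (rankM m (M j m))) (allFin k))

  -- sorted M i m : the i-th (0-based) woman in that sorted list, i.e. the
  -- woman M j m with exactly i women of the list preferred to her.
  -- (The fallback branch is never used when the M j m are distinct.)
  sorted : ∀ {k} → (Fin k → Matching n) → Fin k → Matching n
  sorted M i m with any? (λ j → pos M m j Data.Nat.≟ toℕ i)
  ... | yes (j , _) = M j m
  ... | no _ = M i m

{-# OPTIONS --safe #-}
-- If (m , w) ∈ M p, then m prefers his partner in M l to w exactly when w prefers
-- m to her partner in M l: one direction is stability of M l, the other is
-- opposition of interests between the stable matchings M p and M l, proved by
-- counting.  So the rank of w among m's k partners equals the number of w's
-- partners she ranks below m, and the i-th sorted matching pairs each woman with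
-- the unique one of her partners whom she prefers to exactly i of her k partners;
-- hence it is perfect.  A blocking pair (m , w) would make w rank more than i
-- partners below m, whereas every M l in which m prefers w to his partner (at
-- least k - i of them) gives w a partner she prefers to m.
module Submission where

open import Data.Nat using (ℕ; _≤_; _<_; s≤s; _<?_)
open import Data.Nat.Properties
  using (m≤n⇒m≤1+n; <-cmp; <-trans; <-irrefl; <-asym; <⇒≱; <⇒≢; ≤-<-trans; ≤-refl; module ≤-Reasoning)
  renaming (_≟_ to _≟ℕ_)
open import Data.Fin using (Fin; zero; suc; toℕ; fromℕ<)
open import Data.Fin.Properties using (any?; toℕ-fromℕ<; toℕ-injective; injective⇒≤; _≟_)
  renaming (<-cmp to <-cmpᶠ)
open import Data.List using (List; []; _∷_; length; filter; allFin; lookup)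
open import Data.List.Properties using (length-tabulate; filter-≐; filter-notAll)
open import Data.List.Membership.Propositional using (_∈_)
open import Data.List.Membership.Propositional.Properties using (∈-filter⁺; ∈-filter⁻; ∈-allFin; ∈-lookup)
open import Data.List.Relation.Binary.Sublist.Propositional using (⊆-refl)
import Data.List.Relation.Binary.Sublist.Propositional.Properties as Sublist
open import Data.List.Relation.Unary.All as All using ()
open import Data.List.Relation.Unary.Any as Any using (here; there; index)
open import Data.List.Relation.Unary.Any.Properties using (lookup-index)
open import Data.List.Relation.Unary.AllPairs using (_∷_)
open import Data.List.Relation.Unary.Unique.Propositional using (Unique)
open import Data.List.Relation.Unary.Unique.Propositional.Properties using (filter⁺; allFin⁺)
open import Data.Product using (∃; _×_; _,_; proj₁; proj₂)
open import Data.Sum using (inj₁; inj₂)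
open import Data.Unit using (tt)
open import Function using (_∘_)
open import Function.Definitions using (Injective)
open import Relation.Binary.Definitions using (Tri; tri<; tri≈; tri>)
open import Relation.Binary.PropositionalEquality
open import Relation.Nullary using (¬_; Dec; yes; no; contradiction)
open import Relation.Nullary.Decidable using (_×-dec_; ¬?)
open import Relation.Unary using (Pred; Decidable; _⊆_)
open import Relation.Unary.Properties using (U?)

open import Defs

lookup-injective : ∀ {a} {A : Set a} {xs : List A} → Unique xs →
                   ∀ i j → lookup xs i ≡ lookup xs j → i ≡ j
lookup-injective (_    ∷ _)    zero    zero    _ = refl
lookup-injective (x≢xs ∷ _)    zero    (suc j) e = contradiction e (All.lookup x≢xs (∈-lookup j))
lookup-injective (x≢xs ∷ _)    (suc i) zero    e = contradiction (sym e) (All.lookup x≢xs (∈-lookup i))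
lookup-injective (_    ∷ uniq) (suc i) (suc j) e = cong suc (lookup-injective uniq i j e)

module _ {a p q} {A : Set a} {P : Pred A p} {Q : Pred A q} (P? : Decidable P) (Q? : Decidable Q) where

  length-filter-mono : P ⊆ Q → ∀ xs → length (filter P? xs) ≤ length (filter Q? xs)
  length-filter-mono P⊆Q xs =
    Sublist.length-mono-≤ (Sublist.filter⁺ P? Q? {as = xs} (λ { refl → P⊆Q }) ⊆-refl)

  length-filter-mono-< : P ⊆ Q → ∀ {x xs} → x ∈ xs → Q x → ¬ P x →
                         length (filter P? xs) < length (filter Q? xs)
  length-filter-mono-< P⊆Q {xs = y ∷ xs} x∈ qx ¬px with P? y | Q? y | x∈
  ... | yes py | _      | here refl = contradiction py ¬px
  ... | no _   | no ¬qy | here refl = contradiction qx ¬qy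
  ... | no _   | yes _  | here refl = s≤s (length-filter-mono P⊆Q xs)
  ... | yes _  | yes _  | there x∈′ = s≤s (length-filter-mono-< P⊆Q x∈′ qx ¬px)
  ... | yes py | no ¬qy | there _   = contradiction (P⊆Q py) ¬qy
  ... | no _   | yes _  | there x∈′ = m≤n⇒m≤1+n (length-filter-mono-< P⊆Q x∈′ qx ¬px)
  ... | no _   | no _   | there x∈′ = length-filter-mono-< P⊆Q x∈′ qx ¬px

count : ∀ {k p} {P : Pred (Fin k) p} → Decidable P → ℕ
count {k} P? = length (filter P? (allFin k))

module _ {k p q} {P : Pred (Fin k) p} {Q : Pred (Fin k) q} (P? : Decidable P) (Q? : Decidable Q) where

  count-mono : P ⊆ Q → count P? ≤ count Q?
  count-mono P⊆Q = length-filter-mono P? Q? P⊆Q (allFin k)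

  count-mono-< : P ⊆ Q → ∀ x → Q x → ¬ P x → count P? < count Q?
  count-mono-< P⊆Q x = length-filter-mono-< P? Q? P⊆Q (∈-allFin x)

  count-≐ : P ⊆ Q → Q ⊆ P → count P? ≡ count Q?
  count-≐ P⊆Q Q⊆P = cong length (filter-≐ P? Q? (P⊆Q , Q⊆P) (allFin k))

count-< : ∀ {k p} {P : Pred (Fin k) p} (P? : Decidable P) x → ¬ P x → count P? < k
count-< {k} P? x ¬px = subst (count P? <_) (length-tabulate (λ i → i))
                             (filter-notAll P? (allFin k) (Any.map (λ { refl → ¬px }) (∈-allFin x)))

module _ {a b p q} {P : Pred (Fin a) p} {Q : Pred (Fin b) q} (P? : Decidable P) (Q? : Decidable Q)
         {f : Fin a → Fin b} (f-injective : Injective _≡_ _≡_ f) where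

  count-≤-injection : (∀ {x} → P x → Q (f x)) → count P? ≤ count Q?
  count-≤-injection f-maps = injective⇒≤ {f = slot} slot-injective
    where
    xs = filter P? (allFin a)
    ys = filter Q? (allFin b)
    image∈ys : ∀ i → f (lookup xs i) ∈ ys
    image∈ys i = ∈-filter⁺ Q? (∈-allFin _) (f-maps (proj₂ (∈-filter⁻ P? {xs = allFin a} (∈-lookup i))))
    slot : Fin (length xs) → Fin (length ys)
    slot i = index (image∈ys i)
    slot-injective : Injective _≡_ _≡_ slot
    slot-injective {i} {j} e = lookup-injective (filter⁺ P? (allFin⁺ a)) i j (f-injective (begin
      f (lookup xs i)    ≡⟨ lookup-index (image∈ys i) ⟩
      lookup ys (slot i) ≡⟨ cong (lookup ys) e ⟩
      lookup ys (slot j) ≡⟨ lookup-index (image∈ys j) ⟨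
      f (lookup xs j)    ∎))
      where open ≡-Reasoning

module _ {a b p q} {P : Pred (Fin a) p} {Q : Pred (Fin b) q} (P? : Decidable P) (Q? : Decidable Q)
         {f : Fin a → Fin b} (f-injective : Injective _≡_ _≡_ f) where

  -- Otherwise f would map P injectively into Q minus a point, which is smaller than Q.
  injection-onto : (∀ {x} → P x → Q (f x)) → count Q? ≤ count P? →
                   ∀ {y} → Q y → ∃ λ x → P x × f x ≡ y
  injection-onto f-maps Q≤P {y} qy with any? (λ x → P? x ×-dec (f x ≟ y))
  ... | yes hit = hit
  ... | no miss = contradiction Q≤P (<⇒≱ (≤-<-trans P≤Q-y Q-y<Q))
    where
    Q-y : Pred (Fin b) q
    Q-y z = Q z × z ≢ y
    Q-y? : Decidable Q-y
    Q-y? z = Q? z ×-dec ¬? (z ≟ y)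
    P≤Q-y : count P? ≤ count Q-y?
    P≤Q-y = count-≤-injection P? Q-y? f-injective (λ {x} px → f-maps px , λ fx≡y → miss (x , px , fx≡y))
    Q-y<Q : count Q-y? < count Q?
    Q-y<Q = count-mono-< Q-y? Q? proj₁ y qy (λ (_ , y≢y) → y≢y refl)

injective⇒surjective : ∀ {a} {f : Fin a → Fin a} → Injective _≡_ _≡_ f → ∀ y → ∃ λ x → f x ≡ y
injective⇒surjective f-injective y
  with x , _ , fx≡y ← injection-onto U? U? f-injective _ ≤-refl {y} tt = x , fx≡y

module Preferences {n} (G : Instance n) where
  open Instance G

  prefersM? : ∀ m w w′ → Dec (PrefersM G m w w′)
  prefersM? m w w′ = toℕ (rankM m w) <? toℕ (rankM m w′)

  prefersW? : ∀ w m m′ → Dec (PrefersW G w m m′)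
  prefersW? w m m′ = toℕ (rankW w m) <? toℕ (rankW w m′)

  compareM : ∀ m w w′ → Tri (PrefersM G m w w′) (w ≡ w′) (PrefersM G m w′ w)
  compareM m w w′ with <-cmp (toℕ (rankM m w)) (toℕ (rankM m w′))
  ... | tri< a ¬b ¬c = tri< a (¬b ∘ cong (toℕ ∘ rankM m)) ¬c
  ... | tri≈ ¬a b ¬c = tri≈ ¬a (rankM-inj m (toℕ-injective b)) ¬c
  ... | tri> ¬a ¬b c = tri> ¬a (¬b ∘ cong (toℕ ∘ rankM m)) c

  compareW : ∀ w m m′ → Tri (PrefersW G w m m′) (m ≡ m′) (PrefersW G w m′ m)
  compareW w m m′ with <-cmp (toℕ (rankW w m)) (toℕ (rankW w m′))
  ... | tri< a ¬b ¬c = tri< a (¬b ∘ cong (toℕ ∘ rankW w)) ¬c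
  ... | tri≈ ¬a b ¬c = tri≈ ¬a (rankW-inj w (toℕ-injective b)) ¬c
  ... | tri> ¬a ¬b c = tri> ¬a (¬b ∘ cong (toℕ ∘ rankW w)) c

module StableMatching {n} (G : Instance n) {μ : Matching n} (μ-stable : Stable G μ) where
  open Preferences G

  husband : Woman n → Man n
  husband w = proj₁ (injective⇒surjective (proj₁ μ-stable) w)

  wife∘husband : ∀ w → μ (husband w) ≡ w
  wife∘husband w = proj₂ (injective⇒surjective (proj₁ μ-stable) w)

  husband∘wife : ∀ m → husband (μ m) ≡ m
  husband∘wife m = proj₁ μ-stable (wife∘husband (μ m))

  husband-injective : Injective _≡_ _≡_ husband
  husband-injective {w} {w′} e = trans (sym (wife∘husband w)) (trans (cong μ e) (wife∘husband w′))

  prefersW-husband : ∀ {m w} → PrefersM G m w (μ m) → PrefersW G w (husband w) m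
  prefersW-husband {m} {w} m-envies with compareW w (husband w) m
  ... | tri< w-content _ _ = w-content
  ... | tri≈ _ refl _ =
    contradiction (subst (λ w′ → PrefersM G m w′ (μ m)) (sym (wife∘husband w)) m-envies) (<-irrefl refl)
  ... | tri> _ _ w-envies =
    contradiction ((husband w , wife∘husband w , w-envies) , m-envies) (proj₂ μ-stable m w)

  prefersM-wife : ∀ {m w} → PrefersW G w m (husband w) → PrefersM G m (μ m) w
  prefersM-wife {m} {w} w-envies with compareM m (μ m) w
  ... | tri< m-content _ _ = m-content
  ... | tri≈ _ e _ =
    contradiction (subst (PrefersW G w m) (trans (cong husband (sym e)) (husband∘wife m)) w-envies) (<-irrefl refl)
  ... | tri> _ _ m-envies =
    contradiction ((husband w , wife∘husband w , w-envies) , m-envies) (proj₂ μ-stable m w)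

-- ν maps the men preferring ν to μ injectively to the women preferring μ to ν, and
-- the μ-husband maps these back injectively; so the latter map is onto.
opposition-of-interests : ∀ {n} (G : Instance n) {μ ν : Matching n}
  (μ-stable : Stable G μ) (ν-stable : Stable G ν) {m : Man n} →
  PrefersM G m (ν m) (μ m) → PrefersW G (μ m) m (StableMatching.husband G ν-stable (μ m))
opposition-of-interests {n} G {μ} {ν} μ-stable ν-stable {m} m-prefers-ν =
  subst (λ x → PrefersW G (μ m) x (Sν.husband (μ m))) (Sμ.husband∘wife m) μm-prefers-μ
  where
  module Sμ = StableMatching G μ-stable
  module Sν = StableMatching G ν-stable
  open Preferences G

  A : Pred (Man n) _
  A x = PrefersM G x (ν x) (μ x)
  A? : Decidable A
  A? x = prefersM? x (ν x) (μ x)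
  B : Pred (Woman n) _
  B w = PrefersW G w (Sμ.husband w) (Sν.husband w)
  B? : Decidable B
  B? w = prefersW? w (Sμ.husband w) (Sν.husband w)

  ν-maps : ∀ {x} → A x → B (ν x)
  ν-maps {x} x-prefers-ν =
    subst (PrefersW G (ν x) (Sμ.husband (ν x))) (sym (Sν.husband∘wife x)) (Sμ.prefersW-husband x-prefers-ν)

  husband-maps : ∀ {w} → B w → A (Sμ.husband w)
  husband-maps {w} w-prefers-μ =
    subst (PrefersM G (Sμ.husband w) (ν (Sμ.husband w))) (sym (Sμ.wife∘husband w)) (Sν.prefersM-wife w-prefers-μ)

  A≤B : count A? ≤ count B?
  A≤B = count-≤-injection A? B? (proj₁ ν-stable) ν-maps

  μm-prefers-μ : B (μ m)
  μm-prefers-μ =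
    let w , w-prefers-μ , husband≡m = injection-onto B? A? Sμ.husband-injective husband-maps A≤B m-prefers-ν
    in subst B (trans (sym (Sμ.wife∘husband w)) (cong μ husband≡m)) w-prefers-μ

module _ {n} (G : Instance n) where
  open Instance G

  Dominates⇒EdgeDisjoint : ∀ {μ ν} → Dominates G μ ν → EdgeDisjoint μ ν
  Dominates⇒EdgeDisjoint μ≺ν m μm≡νm = <-irrefl (cong (toℕ ∘ rankM m) μm≡νm) (μ≺ν m)

  increasing⇒IsChain : ∀ {k} (F : Fin k → Matching n) →
                       (∀ {i j} → toℕ i < toℕ j → Dominates G (F i) (F j)) → IsChain G F
  increasing⇒IsChain F increasing i j i≢j with <-cmpᶠ i j
  ... | tri< i<j _ _ = inj₁ (increasing i<j)
  ... | tri≈ _ i≡j _ = contradiction i≡j i≢j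
  ... | tri> _ _ j<i = inj₂ (increasing j<i)

  IsChain⇒EdgeDisjoint : ∀ {k} {F : Fin k → Matching n} → IsChain G F →
                         ∀ i j → i ≢ j → EdgeDisjoint (F i) (F j)
  IsChain⇒EdgeDisjoint chain i j i≢j with chain i j i≢j
  ... | inj₁ Fi≺Fj = Dominates⇒EdgeDisjoint Fi≺Fj
  ... | inj₂ Fj≺Fi = λ m e → Dominates⇒EdgeDisjoint Fj≺Fi m (sym e)

module SortedMatchings {n} (G : Instance n) {k} (M : Fin k → Matching n)
  (M-stable : ∀ i → Stable G (M i)) (M-disjoint : ∀ i j → i ≢ j → EdgeDisjoint (M i) (M j)) where
  open Instance G
  open Preferences G

  husband : Fin k → Woman n → Man n
  husband l = StableMatching.husband G (M-stable l)

  above : Man n → Woman n → ℕ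
  above m w = count (λ l → prefersM? m (M l m) w)

  below : Woman n → Man n → ℕ
  below w x = count (λ l → prefersW? w x (husband l w))

  partner-injective : ∀ m {j j′} → M j m ≡ M j′ m → j ≡ j′
  partner-injective m {j} {j′} e with j ≟ j′
  ... | yes j≡j′ = j≡j′
  ... | no j≢j′ = contradiction e (M-disjoint j j′ j≢j′ m)

  above-mono : ∀ {m w w′} → PrefersM G m w w′ → above m w ≤ above m w′
  above-mono {m} {w} {w′} w<w′ =
    count-mono (λ l → prefersM? m (M l m) w) (λ l → prefersM? m (M l m) w′) (λ l<w → <-trans l<w w<w′)

  above-mono-< : ∀ {m j w} → PrefersM G m (M j m) w → above m (M j m) < above m w
  above-mono-< {m} {j} {w} j<w =
    count-mono-< (λ l → prefersM? m (M l m) (M j m)) (λ l → prefersM? m (M l m) w)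
      (λ l<j → <-trans l<j j<w) j j<w (<-irrefl refl)

  pos<k : ∀ m j → pos G M m j < k
  pos<k m j = count-< (λ l → prefersM? m (M l m) (M j m)) j (<-irrefl refl)

  pos-injective : ∀ m {j j′} → pos G M m j ≡ pos G M m j′ → j ≡ j′
  pos-injective m {j} {j′} e with compareM m (M j m) (M j′ m)
  ... | tri< j<j′ _ _ = contradiction e (<⇒≢ (above-mono-< j<j′))
  ... | tri≈ _ same _ = partner-injective m same
  ... | tri> _ _ j′<j = contradiction (sym e) (<⇒≢ (above-mono-< j′<j))

  pos-surjective : ∀ m i → ∃ λ j → pos G M m j ≡ toℕ i
  pos-surjective m i =
    let j , position≡i = injective⇒surjective position-injective i
    in j , trans (sym (toℕ-fromℕ< (pos<k m j))) (cong toℕ position≡i)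
    where
    position : Fin k → Fin k
    position j = fromℕ< (pos<k m j)
    position-injective : Injective _≡_ _≡_ position
    position-injective {j} {j′} e = pos-injective m (begin
      pos G M m j         ≡⟨ toℕ-fromℕ< (pos<k m j) ⟨
      toℕ (position j)    ≡⟨ cong toℕ e ⟩
      toℕ (position j′)   ≡⟨ toℕ-fromℕ< (pos<k m j′) ⟩
      pos G M m j′        ∎)
      where open ≡-Reasoning

  sorted-pos : ∀ {i m j} → pos G M m j ≡ toℕ i → sorted G M i m ≡ M j m
  sorted-pos {i} {m} {j} pos≡i with any? (λ j → pos G M m j ≟ℕ toℕ i)
  ... | yes (j′ , pos≡i′) = cong (λ l → M l m) (pos-injective m (trans pos≡i′ (sym pos≡i)))
  ... | no none = contradiction (j , pos≡i) none

  sorted-at : ∀ i m → ∃ λ j → pos G M m j ≡ toℕ i × sorted G M i m ≡ M j m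
  sorted-at i m = let j , pos≡i = pos-surjective m i in j , pos≡i , sorted-pos pos≡i

  pos≡below : ∀ x p → pos G M x p ≡ below (M p x) x
  pos≡below x p =
    count-≐ (λ l → prefersM? x (M l x) (M p x)) (λ l → prefersW? (M p x) x (husband l (M p x)))
    (λ {l} → opposition-of-interests G (M-stable p) (M-stable l))
    (λ {l} → StableMatching.prefersM-wife G (M-stable l))

  below≤above : ∀ m w → below w m ≤ above m w
  below≤above m w = count-mono (λ l → prefersW? w m (husband l w)) (λ l → prefersM? m (M l m) w)
    (λ {l} → StableMatching.prefersM-wife G (M-stable l))

  below-mono-< : ∀ {w x y q} → PrefersW G w x y → M q y ≡ w → below w y < below w x
  below-mono-< {x = x} {y} {q} x<y refl =
    count-mono-< (λ l → prefersW? w y (husband l w)) (λ l → prefersW? w x (husband l w))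
      (<-trans x<y) q (subst (PrefersW G w x) (sym husband≡y) x<y)
      (<-irrefl (cong (toℕ ∘ rankW w) (sym husband≡y)))
    where
    w = M q y
    husband≡y : husband q w ≡ y
    husband≡y = StableMatching.husband∘wife G (M-stable q) y

  below-injective : ∀ {w x y p q} → M p x ≡ w → M q y ≡ w → below w x ≡ below w y → x ≡ y
  below-injective {w} {x} {y} px≡w qy≡w e with compareW w x y
  ... | tri< x<y _ _ = contradiction (sym e) (<⇒≢ (below-mono-< x<y qy≡w))
  ... | tri≈ _ x≡y _ = x≡y
  ... | tri> _ _ y<x = contradiction e (<⇒≢ (below-mono-< y<x px≡w))

  sorted-below : ∀ {i x w} → sorted G M i x ≡ w → ∃ λ q → M q x ≡ w × below w x ≡ toℕ i
  sorted-below {i} {x} refl =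
    let q , pos≡i , sorted≡ = sorted-at i x
    in q , sym sorted≡ , (begin
      below (sorted G M i x) x ≡⟨ cong (λ w → below w x) sorted≡ ⟩
      below (M q x) x          ≡⟨ pos≡below x q ⟨
      pos G M x q              ≡⟨ pos≡i ⟩
      toℕ i                    ∎)
    where open ≡-Reasoning

  sorted-increasing : ∀ {i j} → toℕ i < toℕ j → Dominates G (sorted G M i) (sorted G M j)
  sorted-increasing {i} {j} i<j m with sorted-at i m | sorted-at j m
  ... | p , pos≡i , sortedᵢ≡ | q , pos≡j , sortedⱼ≡
    rewrite sortedᵢ≡ | sortedⱼ≡ with compareM m (M p m) (M q m)
  ... | tri< p<q _ _ = p<q
  ... | tri≈ _ same _ = contradiction (trans (sym pos≡i) (trans (cong (above m) same) pos≡j)) (<⇒≢ i<j)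
  ... | tri> _ _ q<p = contradiction (subst₂ _<_ pos≡j pos≡i (above-mono-< q<p)) (<-asym i<j)

  sorted-perfect : ∀ i → IsPerfect (sorted G M i)
  sorted-perfect i {m₁} {m₂} e =
    let q₁ , q₁m₁≡w , below₁≡i = sorted-below {i} refl
        q₂ , q₂m₂≡w , below₂≡i = sorted-below {i} (sym e)
    in below-injective q₁m₁≡w q₂m₂≡w (trans below₁≡i (sym below₂≡i))

  sorted-unblocked : ∀ i m w → ¬ Blocks G (sorted G M i) m w
  sorted-unblocked i m w ((m″ , sorted≡w , w-prefers-m) , m-prefers-w) =
    let p , pos≡i , sorted≡ = sorted-at i m
        q , qm″≡w , below≡i = sorted-below sorted≡w
    in <-irrefl refl (begin-strict
      toℕ i       ≡⟨ below≡i ⟨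
      below w m″  <⟨ below-mono-< w-prefers-m qm″≡w ⟩
      below w m   ≤⟨ below≤above m w ⟩
      above m w   ≤⟨ above-mono (subst (PrefersM G m w) sorted≡ m-prefers-w) ⟩
      pos G M m p ≡⟨ pos≡i ⟩
      toℕ i       ∎)
    where open ≤-Reasoning

  sorted-stable : ∀ i → Stable G (sorted G M i)
  sorted-stable i = sorted-perfect i , sorted-unblocked i

corollary9 : ∀ {n} (G : Instance n) (k : ℕ) (M : Fin k → Matching n)
    → (∀ i → Stable G (M i))
    → (∀ i j → i ≢ j → EdgeDisjoint (M i) (M j))
    → (∀ i → Stable G (sorted G M i))
      × (∀ i j → i ≢ j → EdgeDisjoint (sorted G M i) (sorted G M j))
      × IsChain G (sorted G M)
corollary9 G k M M-stable M-disjoint = sorted-stable , IsChain⇒EdgeDisjoint G chain , chain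
  where
  open SortedMatchings G M M-stable M-disjoint
  chain : IsChain G (sorted G M)
  chain = increasing⇒IsChain G (sorted G M) sorted-increasing
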